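{- Let $G$ be an abelian group, let $A\subseteq G$ be a finite nonempty set, let $q\geq 1$ be an integer and let $\psi:G\to\mathbb{Z}/q\mathbb{Z}$ be a group homomorphism. Suppose that $|(A-A)\setminus\psi^{ -1}([b,b+l])|<|A|/2$ for some $b\in\mathbb{Z}/q\mathbb{Z}$ and some integer $0\leq l<q/3$. Then $\psi(A)\subseteq[x,x+l]$ for some $x\in\mathbb{Z}/q\mathbb{Z}$.
   Context: $A-A=\{a-a':a,a'\in A\}$. For $b\in\mathbb{Z}/q\mathbb{Z}$ and a nonnegative integer $l$, $[b,b+l]$ denotes the set $\{b,b+1,\dots,b+l\}\subseteq\mathbb{Z}/q\mathbb{Z}$. -}

module Defs where

open import Level using (Level; _⊔_)
open import Data.Nat using (ℕ; _+_; _*_; _≤_; _<_; NonZero)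
open import Data.Nat.DivMod using (_mod_)
open import Data.Fin using (Fin; toℕ)
open import Data.List using (List; length)
open import Data.List.Membership.Propositional using (_∈_)
open import Data.List.Relation.Unary.Any using (Any)
open import Data.List.Relation.Unary.All using (All)
open import Data.List.Relation.Unary.AllPairs using (AllPairs)
open import Data.Product using (Σ; ∃; _×_)
open import Relation.Nullary using (¬_)
open import Relation.Binary.PropositionalEquality using (_≡_)
open import Algebra.Bundles using (AbelianGroup)

-- ℤ/qℤ is represented by Fin q (residues 0..q-1), with addition mod q.
addMod : {q : ℕ} .{{_ : NonZero q}} → Fin q → Fin q → Fin q
addMod {q} x y = (toℕ x + toℕ y) mod q

InInterval : {q : ℕ} .{{_ : NonZero q}} → Fin q → ℕ → Fin q → Set
InInterval {q} b l z = Σ ℕ λ i → i ≤ l × z ≡ (toℕ b + i) mod q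

module _ {c ℓ : Level} (G : AbelianGroup c ℓ) where
  open AbelianGroup G

  record IsHomToZmod (q : ℕ) .{{_ : NonZero q}} (ψ : Carrier → Fin q) : Set (c ⊔ ℓ) where
    field
      ψ-cong : ∀ {x y} → x ≈ y → ψ x ≡ ψ y
      ψ-hom  : ∀ x y → ψ (x ∙ y) ≡ addMod (ψ x) (ψ y)

  -- a finite subset of G, enumerated by a duplicate-free list
  Distinct : List Carrier → Set (c ⊔ ℓ)
  Distinct = AllPairs (λ x y → ¬ (x ≈ y))

  InDiff : List Carrier → Carrier → Set (c ⊔ ℓ)
  InDiff A d = ∃ λ a → ∃ λ a' → a ∈ A × a' ∈ A × d ≈ (a - a')

  _∈≈_ : Carrier → List Carrier → Set (c ⊔ ℓ)
  x ∈≈ D = Any (x ≈_) D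

  -- D is a duplicate-free enumeration of the set {d ∈ A - A : ψ d ∉ [b,b+l]},
  -- so that |(A - A) ∖ ψ⁻¹([b,b+l])| = length D
  EnumDiffOutside : (q : ℕ) .{{_ : NonZero q}} (ψ : Carrier → Fin q)
                    (A : List Carrier) (b : Fin q) (l : ℕ) (D : List Carrier) → Set (c ⊔ ℓ)
  EnumDiffOutside q ψ A b l D =
    Distinct D ×
    All (λ d → InDiff A d × ¬ InInterval b l (ψ d)) D ×
    (∀ d → InDiff A d → ¬ InInterval b l (ψ d) → d ∈≈ D)

{-# OPTIONS --safe #-}
module Submission where

-- Given u, w ∈ A, each of u and w rules out at most |D| choices of v ∈ A (as v ↦ u - v is injective),
-- so 2|D| < |A| leaves a v with ψ(u - v), ψ(w - v) ∈ [b, b + l], i.e. ψ(u), ψ(w) ∈ [c, c + l] for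
-- c = b + ψ(v). A finite set in ℤ/qℤ whose points pairwise share an interval of length l lies in a
-- single one once 3l < q: fix a point s and measure offsets from s - l. They are at most 2l, and two
-- points sharing an interval have offsets within l of each other, since sums of at most 3l cannot
-- wrap around q. Hence [s - l + t₀, s - l + t₀ + l] works for the least offset t₀.

open import Defs
open import Level using (Level)
open import Algebra.Bundles using (AbelianGroup)
import Algebra.Properties.AbelianGroup as AbelianGroupProperties
import Algebra.Properties.CommutativeSemigroup as CommutativeSemigroupProperties
open import Data.Empty using (⊥-elim)
open import Data.Fin as Fin using (Fin; zero; toℕ; _≟_; _↑ˡ_; _↑ʳ_; splitAt)
open import Data.Fin.Properties
  using (toℕ<n; toℕ-injective; toℕ-fromℕ<; injective⇒≤; splitAt-↑ˡ; splitAt-↑ʳ; any?)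
open import Data.List using (List; []; _∷_; length; lookup; allFin)
open import Data.List.Extrema.Nat using (argmin; f[argmin]≤f[xs])
open import Data.List.Membership.Propositional.Properties using (∈-lookup; ∈-allFin)
import Data.List.Relation.Unary.All as All
open import Data.List.Relation.Unary.AllPairs using (_∷_)
open import Data.List.Relation.Unary.Any using (index)
open import Data.List.Relation.Unary.Any.Properties using (lookup-index)
import Data.List.Relation.Unary.Unique.Setoid as UniqueSetoid
open import Data.Nat using (ℕ; suc; _+_; _*_; _∸_; _≤_; _<_; s≤s; s≤s⁻¹; NonZero)
open import Data.Nat.DivMod using (_%_; _mod_; %-distribˡ-+; m%n%n≡m%n; m%n<n; m<n⇒m%n≡m; [m+n]%n≡m%n)
open import Data.Nat.Properties
  using (+-assoc; +-comm; +-identityʳ; +-mono-≤; +-monoʳ-≤; ≤-trans; <⇒≤; <⇒≱; m≤m+n; m∸n≤m;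
         m∸n+n≡m; m+[n∸m]≡n; m≤n+o⇒m∸n≤o; +-commutativeSemigroup; anyUpTo?; module ≤-Reasoning)
open import Data.Product using (Σ; ∃; _×_; _,_; proj₁; proj₂)
open import Data.Sum using (_⊎_; inj₁; inj₂; [_,_]′)
open import Relation.Binary.Bundles using (Setoid)
open import Relation.Binary.PropositionalEquality
  using (_≡_; refl; sym; trans; cong; subst; module ≡-Reasoning)
open import Relation.Nullary using (¬_; yes; no; contradiction)
open import Relation.Nullary.Decidable using (map′; _×-dec_)
open import Relation.Unary using (Pred; Decidable)

module _ {r : Level} where

  total-injectiveRel⇒≤ : ∀ {n m} (R : Fin n → Fin m → Set r) → (∀ {v w k} → R v k → R w k → v ≡ w) →
                         (∀ v → ∃ (R v)) → n ≤ m
  total-injectiveRel⇒≤ R unique total =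
    injective⇒≤ λ {v} {w} eq → unique (proj₂ (total v)) (subst (R w) (sym eq) (proj₂ (total w)))

  covered-by-two-injectiveRels⇒≤ : ∀ {n m} (R S : Fin n → Fin m → Set r) →
    (∀ {v w k} → R v k → R w k → v ≡ w) → (∀ {v w k} → S v k → S w k → v ≡ w) →
    (∀ v → ∃ (R v) ⊎ ∃ (S v)) → n ≤ 2 * m
  covered-by-two-injectiveRels⇒≤ {n} {m} R S R-unique S-unique cover =
    subst (n ≤_) (cong (m +_) (sym (+-identityʳ m)))
      (total-injectiveRel⇒≤ R⊎S (λ {_} {_} {k} → unique k) total)
    where
      R⊎S : Fin n → Fin (m + m) → Set r
      R⊎S v k = [ R v , S v ]′ (splitAt m k)

      unique : ∀ {v w} k → R⊎S v k → R⊎S w k → v ≡ w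
      unique k with splitAt m k
      ... | inj₁ _ = R-unique
      ... | inj₂ _ = S-unique

      total : ∀ v → ∃ (R⊎S v)
      total v with cover v
      ... | inj₁ (k , r) = k ↑ˡ m , subst [ R v , S v ]′ (sym (splitAt-↑ˡ m k m)) r
      ... | inj₂ (k , s) = m ↑ʳ k , subst [ R v , S v ]′ (sym (splitAt-↑ʳ m m k)) s

module _ {a ℓ : Level} (S : Setoid a ℓ) where
  open Setoid S using (_≈_) renaming (sym to ≈-sym)
  open UniqueSetoid S using (Unique)

  lookup-injective : ∀ {xs} → Unique xs → ∀ {v w} → lookup xs v ≈ lookup xs w → v ≡ w
  lookup-injective (_ ∷ _)    {zero}      {zero}      _  = refl
  lookup-injective (x≉xs ∷ _) {zero}      {Fin.suc w} eq = contradiction eq (All.lookup x≉xs (∈-lookup w))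
  lookup-injective (x≉xs ∷ _) {Fin.suc v} {zero}      eq = contradiction (≈-sym eq) (All.lookup x≉xs (∈-lookup v))
  lookup-injective (_ ∷ uniq) {Fin.suc v} {Fin.suc w} eq = cong Fin.suc (lookup-injective uniq eq)

module Residues (q : ℕ) .{{_ : NonZero q}} where

  infix 4 _≡ₘ_
  _≡ₘ_ : ℕ → ℕ → Set
  m ≡ₘ n = m % q ≡ n % q

  %-≡ₘ : ∀ m → m % q ≡ₘ m
  %-≡ₘ m = m%n%n≡m%n m q

  +-congʳ-≡ₘ : ∀ {m n} o → m ≡ₘ n → m + o ≡ₘ n + o
  +-congʳ-≡ₘ {m} {n} o m≡n = begin
    (m + o) % q          ≡⟨ %-distribˡ-+ m o q ⟩
    (m % q + o % q) % q  ≡⟨ cong (λ k → (k + o % q) % q) m≡n ⟩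
    (n % q + o % q) % q  ≡⟨ %-distribˡ-+ n o q ⟨
    (n + o) % q          ∎
    where open ≡-Reasoning

  +-congˡ-≡ₘ : ∀ o {m n} → m ≡ₘ n → o + m ≡ₘ o + n
  +-congˡ-≡ₘ o {m} {n} m≡n =
    trans (cong (_% q) (+-comm o m)) (trans (+-congʳ-≡ₘ o m≡n) (cong (_% q) (+-comm n o)))

  +-inverseˡ-≡ₘ : ∀ o m → (q ∸ o % q) + (o + m) ≡ₘ m
  +-inverseˡ-≡ₘ o m = begin
    ((q ∸ o % q) + (o + m)) % q      ≡⟨ +-congˡ-≡ₘ (q ∸ o % q) (+-congʳ-≡ₘ m (sym (%-≡ₘ o))) ⟩
    ((q ∸ o % q) + (o % q + m)) % q  ≡⟨ cong (_% q) (sym (+-assoc (q ∸ o % q) (o % q) m)) ⟩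
    ((q ∸ o % q) + o % q + m) % q    ≡⟨ cong (λ k → (k + m) % q) (m∸n+n≡m (<⇒≤ (m%n<n o q))) ⟩
    (q + m) % q                      ≡⟨ cong (_% q) (+-comm q m) ⟩
    (m + q) % q                      ≡⟨ [m+n]%n≡m%n m q ⟩
    m % q                            ∎
    where open ≡-Reasoning

  +-cancelˡ-≡ₘ : ∀ o {m n} → o + m ≡ₘ o + n → m ≡ₘ n
  +-cancelˡ-≡ₘ o {m} {n} eq =
    trans (sym (+-inverseˡ-≡ₘ o m)) (trans (+-congˡ-≡ₘ (q ∸ o % q) eq) (+-inverseˡ-≡ₘ o n))

  +-cancelʳ-≡ₘ : ∀ o {m n} → m + o ≡ₘ n + o → m ≡ₘ n
  +-cancelʳ-≡ₘ o {m} {n} eq =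
    +-cancelˡ-≡ₘ o (trans (cong (_% q) (+-comm o m)) (trans eq (cong (_% q) (+-comm n o))))

  ≡ₘ⇒≡ : ∀ {m n} → m < q → n < q → m ≡ₘ n → m ≡ n
  ≡ₘ⇒≡ m<q n<q eq = trans (sym (m<n⇒m%n≡m m<q)) (trans eq (m<n⇒m%n≡m n<q))

  Within : ℕ → ℕ → ℕ → Set
  Within x l y = Σ ℕ λ i → i ≤ l × y ≡ₘ x + i

  ShareInterval : ℕ → ℕ → ℕ → Set
  ShareInterval l y z = ∃ λ c → Within c l y × Within c l z

  Within-+ʳ : ∀ {x l y} o → Within x l y → Within (x + o) l (y + o)
  Within-+ʳ {x} o (i , i≤l , y≡x+i) =
    i , i≤l , trans (+-congʳ-≡ₘ o y≡x+i) (cong (_% q) (xy∙z≈xz∙y x i o))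
    where open CommutativeSemigroupProperties +-commutativeSemigroup using (xy∙z≈xz∙y)

  Within-resp-≡ₘ : ∀ {x l y y'} → y ≡ₘ y' → Within x l y → Within x l y'
  Within-resp-≡ₘ y≡y' (i , i≤l , y≡x+i) = i , i≤l , trans (sym y≡y') y≡x+i

  toℕ-mod-≡ₘ : ∀ n → toℕ (n mod q) ≡ₘ n
  toℕ-mod-≡ₘ n = trans (cong (_% q) (toℕ-fromℕ< (m%n<n n q))) (%-≡ₘ n)

  ≡ₘ⇒≡mod : ∀ {z : Fin q} {n} → toℕ z ≡ₘ n → z ≡ n mod q
  ≡ₘ⇒≡mod {z} {n} eq = toℕ-injective (begin
    toℕ z            ≡⟨ m<n⇒m%n≡m (toℕ<n z) ⟨
    toℕ z % q        ≡⟨ eq ⟩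
    n % q            ≡⟨ toℕ-fromℕ< (m%n<n n q) ⟨
    toℕ (n mod q)    ∎)
    where open ≡-Reasoning

  InInterval⇒Within : ∀ {x l z} → InInterval x l z → Within (toℕ x) l (toℕ z)
  InInterval⇒Within {x} (i , i≤l , refl) = i , i≤l , toℕ-mod-≡ₘ (toℕ x + i)

  Within⇒InInterval : ∀ {x l} {z : Fin q} → Within x l (toℕ z) → InInterval (x mod q) l z
  Within⇒InInterval {x} (i , i≤l , z≡x+i) =
    i , i≤l , ≡ₘ⇒≡mod (trans z≡x+i (+-congʳ-≡ₘ i (sym (toℕ-mod-≡ₘ x))))

  InInterval? : ∀ x l → Decidable (InInterval x l)
  InInterval? x l z =
    map′ (λ (i , i<1+l , eq) → i , s≤s⁻¹ i<1+l , eq) (λ (i , i≤l , eq) → i , s≤s i≤l , eq)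
      (anyUpTo? (λ i → z ≟ (toℕ x + i) mod q) (suc l))

  module _ {l : ℕ} (3l<q : 3 * l < q) where

    private
      l≤q : l ≤ q
      l≤q = ≤-trans (m≤m+n l (2 * l)) (<⇒≤ 3l<q)

      2l+l<q : ∀ {t j} → t ≤ l + l → j ≤ l → t + j < q
      2l+l<q {t} {j} t≤2l j≤l = begin-strict
        t + j            ≤⟨ +-mono-≤ t≤2l j≤l ⟩
        l + l + l        ≡⟨ +-assoc l l l ⟩
        l + (l + l)      ≡⟨ cong (λ k → l + (l + k)) (+-identityʳ l) ⟨
        3 * l            <⟨ 3l<q ⟩
        q                ∎
        where open ≤-Reasoning

    shifted-base : ∀ s → s + (q ∸ l) + l ≡ₘ s
    shifted-base s = begin
      (s + (q ∸ l) + l) % q    ≡⟨ cong (_% q) (+-assoc s (q ∸ l) l) ⟩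
      (s + ((q ∸ l) + l)) % q  ≡⟨ cong (λ k → (s + k) % q) (m∸n+n≡m l≤q) ⟩
      (s + q) % q              ≡⟨ [m+n]%n≡m%n s q ⟩
      s % q                    ∎
      where open ≡-Reasoning

    offset-from : ∀ {B s y} → B + l ≡ₘ s → ShareInterval l s y → ∃ λ t → t ≤ l + l × y ≡ₘ B + t
    offset-from {B} {s} {y} B+l≡s (c , (i , i≤l , s≡c+i) , (j , j≤l , y≡c+j)) =
      (l ∸ i) + j , +-mono-≤ (m∸n≤m l i) j≤l , (begin
        y % q                  ≡⟨ y≡c+j ⟩
        (c + j) % q            ≡⟨ +-congʳ-≡ₘ j c≡B+[l∸i] ⟩
        (B + (l ∸ i) + j) % q  ≡⟨ cong (_% q) (+-assoc B (l ∸ i) j) ⟩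
        (B + (l ∸ i + j)) % q  ∎)
      where
        open ≡-Reasoning
        c≡B+[l∸i] : c ≡ₘ B + (l ∸ i)
        c≡B+[l∸i] = +-cancelʳ-≡ₘ i (begin
          (c + i) % q            ≡⟨ s≡c+i ⟨
          s % q                  ≡⟨ B+l≡s ⟨
          (B + l) % q            ≡⟨ cong (λ k → (B + k) % q) (m∸n+n≡m i≤l) ⟨
          (B + (l ∸ i + i)) % q  ≡⟨ cong (_% q) (+-assoc B (l ∸ i) i) ⟨
          (B + (l ∸ i) + i) % q  ∎)

    -- 3l < q keeps t + j and t' + i below q, so their congruence is an equality.
    offsets-close : ∀ B {y z t t'} → t ≤ l + l → t' ≤ l + l → y ≡ₘ B + t → z ≡ₘ B + t' →
                    ShareInterval l y z → t' ≤ t + l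
    offsets-close B {y} {z} {t} {t'} t≤2l t'≤2l y≡B+t z≡B+t'
                  (c , (i , i≤l , y≡c+i) , (j , j≤l , z≡c+j)) =
      begin
        t'      ≤⟨ m≤m+n t' i ⟩
        t' + i  ≡⟨ t+j≡t'+i ⟨
        t + j   ≤⟨ +-monoʳ-≤ t j≤l ⟩
        t + l   ∎
      where
        open ≤-Reasoning
        open CommutativeSemigroupProperties +-commutativeSemigroup using (xy∙z≈xz∙y)
        t+j≡ₘt'+i : t + j ≡ₘ t' + i
        t+j≡ₘt'+i = +-cancelˡ-≡ₘ B (begin-equality
          (B + (t + j)) % q  ≡⟨ cong (_% q) (+-assoc B t j) ⟨
          (B + t + j) % q    ≡⟨ +-congʳ-≡ₘ j y≡B+t ⟨
          (y + j) % q        ≡⟨ +-congʳ-≡ₘ j y≡c+i ⟩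
          (c + i + j) % q    ≡⟨ cong (_% q) (xy∙z≈xz∙y c i j) ⟩
          (c + j + i) % q    ≡⟨ +-congʳ-≡ₘ i z≡c+j ⟨
          (z + i) % q        ≡⟨ +-congʳ-≡ₘ i z≡B+t' ⟩
          (B + t' + i) % q   ≡⟨ cong (_% q) (+-assoc B t' i) ⟩
          (B + (t' + i)) % q ∎)
        t+j≡t'+i : t + j ≡ t' + i
        t+j≡t'+i = ≡ₘ⇒≡ (2l+l<q t≤2l j≤l) (2l+l<q t'≤2l i≤l) t+j≡ₘt'+i

    pairwise-share⇒within : ∀ {n} (p : Fin (suc n) → ℕ) → (∀ u w → ShareInterval l (p u) (p w)) →
                            ∃ λ x → ∀ k → Within x l (p k)
    pairwise-share⇒within {n} p share = B + t k₀ , within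
      where
        B : ℕ
        B = p zero + (q ∸ l)

        offset : ∀ k → ∃ λ t → t ≤ l + l × p k ≡ₘ B + t
        offset k = offset-from (shifted-base (p zero)) (share zero k)

        t : Fin (suc n) → ℕ
        t k = proj₁ (offset k)

        t≤2l : ∀ k → t k ≤ l + l
        t≤2l k = proj₁ (proj₂ (offset k))

        p≡B+t : ∀ k → p k ≡ₘ B + t k
        p≡B+t k = proj₂ (proj₂ (offset k))

        k₀ : Fin (suc n)
        k₀ = argmin t zero (allFin (suc n))

        t₀≤t : ∀ k → t k₀ ≤ t k
        t₀≤t k = All.lookup (f[argmin]≤f[xs] {f = t} zero (allFin (suc n))) (∈-allFin k)

        t≤t₀+l : ∀ k → t k ≤ t k₀ + l
        t≤t₀+l k = offsets-close B (t≤2l k₀) (t≤2l k) (p≡B+t k₀) (p≡B+t k) (share k₀ k)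

        within : ∀ k → Within (B + t k₀) l (p k)
        within k = t k ∸ t k₀ , m≤n+o⇒m∸n≤o (t k) (t k₀) (t≤t₀+l k) , (begin
          p k % q                          ≡⟨ p≡B+t k ⟩
          (B + t k) % q                    ≡⟨ cong (λ s → (B + s) % q) (m+[n∸m]≡n (t₀≤t k)) ⟨
          (B + (t k₀ + (t k ∸ t k₀))) % q  ≡⟨ cong (_% q) (+-assoc B (t k₀) _) ⟨
          (B + t k₀ + (t k ∸ t k₀)) % q    ∎)
          where open ≡-Reasoning

module _ {c ℓ : Level} (G : AbelianGroup c ℓ) where
  open AbelianGroup G using (Carrier; setoid; _≈_; _∙_; _-_)
    renaming (refl to ≈-refl; sym to ≈-sym; trans to ≈-trans)
  open AbelianGroupProperties G using (∙-cancelˡ; ⁻¹-injective; //-rightDividesˡ)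

  -‿cancelˡ : ∀ u {x y} → u - x ≈ u - y → x ≈ y
  -‿cancelˡ u eq = ⁻¹-injective (∙-cancelˡ u _ _ eq)

  module _ {p : Level} {Good : Pred Carrier p} (good? : Decidable Good) {A D : List Carrier}
           (distinct : Distinct G A) (bad∈D : ∀ d → InDiff G A d → ¬ Good d → _∈≈_ G d D) where

    common-good-point : 2 * length D < length A → ∀ u w →
                        ∃ λ v → Good (lookup A u - lookup A v) × Good (lookup A w - lookup A v)
    common-good-point 2|D|<|A| u w
      with any? (λ v → good? (lookup A u - lookup A v) ×-dec good? (lookup A w - lookup A v))
    ... | yes found = found
    ... | no none = contradiction
          (covered-by-two-injectiveRels⇒≤ (Witness u) (Witness w)
             (witness-unique u) (witness-unique w) cover)
          (<⇒≱ 2|D|<|A|)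
      where
        Witness : Fin (length A) → Fin (length A) → Fin (length D) → Set ℓ
        Witness u v k = lookup A u - lookup A v ≈ lookup D k

        witness-unique : ∀ u {v v' k} → Witness u v k → Witness u v' k → v ≡ v'
        witness-unique u r s =
          lookup-injective setoid distinct (-‿cancelˡ (lookup A u) (≈-trans r (≈-sym s)))

        witness : ∀ u v → ¬ Good (lookup A u - lookup A v) → ∃ (Witness u v)
        witness u v bad = index d∈D , lookup-index d∈D
          where d∈D = bad∈D _ (lookup A u , lookup A v , ∈-lookup u , ∈-lookup v , ≈-refl) bad

        cover : ∀ v → ∃ (Witness u v) ⊎ ∃ (Witness w v)
        cover v with good? (lookup A u - lookup A v)
        ... | no bad    = inj₁ (witness u v bad)
        ... | yes goodᵤ = inj₂ (witness w v λ goodʷ → none (v , goodᵤ , goodʷ))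

  module _ {q : ℕ} .{{_ : NonZero q}} {ψ : Carrier → Fin q} (hom : IsHomToZmod G q ψ) where
    open IsHomToZmod hom
    open Residues q

    ψ-diff : ∀ a a' → toℕ (ψ a) ≡ₘ toℕ (ψ (a - a')) + toℕ (ψ a')
    ψ-diff a a' = begin
      toℕ (ψ a) % q                         ≡⟨ cong (λ x → toℕ x % q) (ψ-cong (≈-sym (//-rightDividesˡ a' a))) ⟩
      toℕ (ψ ((a - a') ∙ a')) % q           ≡⟨ cong (λ x → toℕ x % q) (ψ-hom (a - a') a') ⟩
      toℕ (addMod (ψ (a - a')) (ψ a')) % q  ≡⟨ toℕ-mod-≡ₘ _ ⟩
      (toℕ (ψ (a - a')) + toℕ (ψ a')) % q   ∎
      where open ≡-Reasoning

    InInterval-diff⇒Within : ∀ {b l a a'} → InInterval b l (ψ (a - a')) →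
                             Within (toℕ b + toℕ (ψ a')) l (toℕ (ψ a))
    InInterval-diff⇒Within {a = a} {a'} a-a'∈I =
      Within-resp-≡ₘ (sym (ψ-diff a a')) (Within-+ʳ (toℕ (ψ a')) (InInterval⇒Within a-a'∈I))

lemma2p3 : {c ℓ : Level} (G : AbelianGroup c ℓ) (q : ℕ) .{{_ : NonZero q}}
    (ψ : AbelianGroup.Carrier G → Fin q) → IsHomToZmod G q ψ →
    (A : List (AbelianGroup.Carrier G)) → Distinct G A → ¬ (A ≡ []) →
    (b : Fin q) (l : ℕ) → 3 * l < q →
    (D : List (AbelianGroup.Carrier G)) → EnumDiffOutside G q ψ A b l D →
    2 * length D < length A →
    Σ (Fin q) λ x → ∀ a → _∈≈_ G a A → InInterval x l (ψ a)
lemma2p3 G q ψ hom [] _ A≢[] _ _ _ _ _ _ = ⊥-elim (A≢[] refl)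
lemma2p3 G q ψ hom A@(_ ∷ _) distinct _ b l 3l<q D (_ , _ , bad∈D) 2|D|<|A| = x mod q , ψ[A]⊆[x,x+l]
  where
    open Residues q
    open IsHomToZmod hom using (ψ-cong)

    share : ∀ u w → ShareInterval l (toℕ (ψ (lookup A u))) (toℕ (ψ (lookup A w)))
    share u w =
      let v , goodᵤ , goodʷ = common-good-point G (λ d → InInterval? b l (ψ d)) distinct bad∈D 2|D|<|A| u w
      in  toℕ b + toℕ (ψ (lookup A v)) ,
          InInterval-diff⇒Within G hom goodᵤ , InInterval-diff⇒Within G hom goodʷ

    interval : ∃ λ x → ∀ k → Within x l (toℕ (ψ (lookup A k)))
    interval = pairwise-share⇒within 3l<q (λ k → toℕ (ψ (lookup A k))) share

    x : ℕ
    x = proj₁ interval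

    ψ[A]⊆[x,x+l] : ∀ a → _∈≈_ G a A → InInterval (x mod q) l (ψ a)
    ψ[A]⊆[x,x+l] a a∈A = subst (InInterval (x mod q) l) (sym (ψ-cong (lookup-index a∈A)))
                            (Within⇒InInterval (proj₂ interval (index a∈A)))
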